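{- Let $L=\{(x,\sqrt2\,y): x,y\in\mathbb{Z}\}\subset\mathbb{R}^2$. Then no four points of $L$ form the vertices of a non-degenerate square. -}

module Defs where

open import Data.Integer using (ℤ; _+_; _-_; _*_; +_)
open import Data.Product using (_×_; _,_)
open import Relation.Binary.PropositionalEquality using (_≡_)
open import Relation.Nullary using (¬_)

-- A point of L = {(x, √2·y) : x, y ∈ ℤ} ⊂ ℝ² is recorded by its
-- integer parameters (x , y); it denotes the real point (x, √2 y).
-- The map (x , y) ↦ (x, √2 y) is injective, so equality of points of L
-- is equality of the integer pairs.
LPoint : Set
LPoint = ℤ × ℤ

vec : LPoint → LPoint → ℤ × ℤ
vec (x₁ , y₁) (x₂ , y₂) = (x₂ - x₁ , y₂ - y₁)

-- Euclidean inner product of the real vectors (a₁, √2 b₁) and (a₂, √2 b₂):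
-- a₁ a₂ + (√2 b₁)(√2 b₂) = a₁ a₂ + 2 b₁ b₂.
dot : ℤ × ℤ → ℤ × ℤ → ℤ
dot (a₁ , b₁) (a₂ , b₂) = a₁ * a₂ + (+ 2) * (b₁ * b₂)

IsSquare : LPoint → LPoint → LPoint → LPoint → Set
IsSquare A B C D =
  (vec A B ≡ vec D C) ×
  (dot (vec A B) (vec A D) ≡ + 0) ×
  (dot (vec A B) (vec A B) ≡ dot (vec A D) (vec A D)) ×
  (¬ (A ≡ B))

-- With Q(a , b) = a² + 2b² the squared length of (a, √2 b), Lagrange's identity
-- reads Q(u) Q(v) = (u · v)² + 2 det(u, v)².  At the corner A of a square the side
-- vectors u, v satisfy u · v = 0 and Q(u) = Q(v), so Q(u)² = 2 det(u, v)².  Since √2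
-- is irrational this forces Q(u) = 0, hence u = 0 and the square is degenerate.
module Submission where

open import Data.Integer as ℤ using (ℤ; +_; -[1+_]; ∣_∣; _+_; _*_; _-_)
open import Data.Integer.Properties as ℤ using ()
import Data.Integer.Tactic.RingSolver as ℤ-Solver
open import Data.Nat as ℕ using (ℕ; zero; suc; _<_)
open import Data.Nat.Divisibility using (_∣_; divides)
open import Data.Nat.Induction using (<-rec)
open import Data.Nat.Primality using (Prime; prime[2]; euclidsLemma; prime⇒nonZero; prime⇒nonTrivial)
open import Data.Nat.Properties as ℕ using ()
import Data.Nat.Tactic.RingSolver as ℕ-Solver
open import Data.Product using (_×_; _,_; ∃-syntax)
open import Data.Product.Properties using (,-injective)
open import Data.Sum using ([_,_]′)
open import Function using (id)
open import Relation.Binary.PropositionalEquality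
open import Relation.Nullary using (¬_)

open import Defs

m*m≡0⇒m≡0 : ∀ m → m ℕ.* m ≡ 0 → m ≡ 0
m*m≡0⇒m≡0 m eq = [ id , id ]′ (ℕ.m*n≡0⇒m≡0∨n≡0 m eq)

i*i≡+∣i∣*∣i∣ : ∀ i → i * i ≡ + (∣ i ∣ ℕ.* ∣ i ∣)
i*i≡+∣i∣*∣i∣ (+ n)    = ℤ.+◃n≡+n (n ℕ.* n)
i*i≡+∣i∣*∣i∣ -[1+ n ] = ℤ.+◃n≡+n (suc n ℕ.* suc n)

module _ {p : ℕ} (p-prime : Prime p) where
  private instance
    p≢0 = prime⇒nonZero p-prime
    p>1 = prime⇒nonTrivial p-prime

  p∣m*m⇒p∣m : ∀ m → p ∣ m ℕ.* m → p ∣ m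
  p∣m*m⇒p∣m m p∣m*m = [ id , id ]′ (euclidsLemma m m p-prime p∣m*m)

  m*m≡p*[n*n]⇒m≡k*p : ∀ m n → m ℕ.* m ≡ p ℕ.* (n ℕ.* n) →
                      ∃[ k ] m ≡ k ℕ.* p × n ℕ.* n ≡ p ℕ.* (k ℕ.* k)
  m*m≡p*[n*n]⇒m≡k*p m n eq with p∣m*m⇒p∣m m (divides (n ℕ.* n) (trans eq (ℕ.*-comm p _)))
  ... | divides k refl = k , refl , sym (ℕ.*-cancelˡ-≡ _ _ p (begin
    p ℕ.* (p ℕ.* (k ℕ.* k))    ≡⟨ rearrange k p ⟩
    k ℕ.* p ℕ.* (k ℕ.* p)      ≡⟨ eq ⟩
    p ℕ.* (n ℕ.* n)            ∎))
    where
    open ≡-Reasoning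
    rearrange : ∀ x y → y ℕ.* (y ℕ.* (x ℕ.* x)) ≡ x ℕ.* y ℕ.* (x ℕ.* y)
    rearrange = ℕ-Solver.solve-∀

  -- Infinite descent: m² = p n² gives m = k p and n² = p k², then n = j p and
  -- k² = p j², a solution (k , j) with k < m unless k = 0.
  m*m≡p*[n*n]⇒m≡0 : ∀ m n → m ℕ.* m ≡ p ℕ.* (n ℕ.* n) → m ≡ 0
  m*m≡p*[n*n]⇒m≡0 = <-rec _ descent
    where
    descent : ∀ m → (∀ {k} → k < m → ∀ n → k ℕ.* k ≡ p ℕ.* (n ℕ.* n) → k ≡ 0) →
              ∀ n → m ℕ.* m ≡ p ℕ.* (n ℕ.* n) → m ≡ 0
    descent m rec n eq with m*m≡p*[n*n]⇒m≡k*p m n eq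
    ... | zero  , refl , _   = refl
    ... | suc k , refl , eq′ with m*m≡p*[n*n]⇒m≡k*p n (suc k) eq′
    ...   | j , refl , eq″ with rec (ℕ.m<m*n (suc k) p (ℕ.nonTrivial⇒n>1 p)) j eq″
    ...     | ()

  i*i≡p*[j*j]⇒i≡0 : ∀ i j → i * i ≡ + p * (j * j) → i ≡ + 0
  i*i≡p*[j*j]⇒i≡0 i j eq = ℤ.∣i∣≡0⇒i≡0 (m*m≡p*[n*n]⇒m≡0 ∣ i ∣ ∣ j ∣ (begin
    ∣ i ∣ ℕ.* ∣ i ∣            ≡⟨ ℤ.abs-* i i ⟨
    ∣ i * i ∣                  ≡⟨ cong ∣_∣ eq ⟩
    ∣ + p * (j * j) ∣          ≡⟨ ℤ.abs-* (+ p) (j * j) ⟩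
    p ℕ.* ∣ j * j ∣            ≡⟨ cong (p ℕ.*_) (ℤ.abs-* j j) ⟩
    p ℕ.* (∣ j ∣ ℕ.* ∣ j ∣)    ∎))
    where open ≡-Reasoning

-- The cross product of the real vectors (a₁, √2 b₁) and (a₂, √2 b₂) is √2 · det.
det : ℤ × ℤ → ℤ × ℤ → ℤ
det (a₁ , b₁) (a₂ , b₂) = a₁ * b₂ - b₁ * a₂

dot*dot≡dot²+2det² : ∀ u v → dot u u * dot v v ≡ dot u v * dot u v + + 2 * (det u v * det u v)
dot*dot≡dot²+2det² (a₁ , b₁) (a₂ , b₂) = lagrange a₁ b₁ a₂ b₂
  where
  lagrange : ∀ a₁ b₁ a₂ b₂ →
             (a₁ * a₁ + + 2 * (b₁ * b₁)) * (a₂ * a₂ + + 2 * (b₂ * b₂))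
             ≡ (a₁ * a₂ + + 2 * (b₁ * b₂)) * (a₁ * a₂ + + 2 * (b₁ * b₂))
               + + 2 * ((a₁ * b₂ - b₁ * a₂) * (a₁ * b₂ - b₁ * a₂))
  lagrange = ℤ-Solver.solve-∀

dot-self≡0⇒≡0 : ∀ u → dot u u ≡ + 0 → u ≡ (+ 0 , + 0)
dot-self≡0⇒≡0 (a , b) eq = cong₂ _,_
  (ℤ.∣i∣≡0⇒i≡0 (m*m≡0⇒m≡0 ∣ a ∣ (ℕ.m+n≡0⇒m≡0 a² norm≡0)))
  (ℤ.∣i∣≡0⇒i≡0 (m*m≡0⇒m≡0 ∣ b ∣ ([ (λ ()) , id ]′ (ℕ.m*n≡0⇒m≡0∨n≡0 2 (ℕ.m+n≡0⇒n≡0 a² norm≡0)))))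
  where
  open ≡-Reasoning
  a² b² : ℕ
  a² = ∣ a ∣ ℕ.* ∣ a ∣
  b² = ∣ b ∣ ℕ.* ∣ b ∣
  norm≡0 : a² ℕ.+ 2 ℕ.* b² ≡ 0
  norm≡0 = ℤ.+-injective (begin
    + (a² ℕ.+ 2 ℕ.* b²)        ≡⟨ ℤ.pos-+ a² (2 ℕ.* b²) ⟩
    + a² + + (2 ℕ.* b²)        ≡⟨ cong (_+_ (+ a²)) (ℤ.pos-* 2 b²) ⟩
    + a² + + 2 * + b²          ≡⟨ cong₂ (λ x y → x + + 2 * y) (i*i≡+∣i∣*∣i∣ a) (i*i≡+∣i∣*∣i∣ b) ⟨
    a * a + + 2 * (b * b)      ≡⟨ eq ⟩
    + 0                        ∎)

⊥-equal-length⇒≡0 : ∀ u v → dot u v ≡ + 0 → dot u u ≡ dot v v → u ≡ (+ 0 , + 0)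
⊥-equal-length⇒≡0 u v u⊥v ∣u∣≡∣v∣ =
  dot-self≡0⇒≡0 u (i*i≡p*[j*j]⇒i≡0 prime[2] (dot u u) (det u v) (begin
    dot u u * dot u u               ≡⟨ cong (dot u u *_) ∣u∣≡∣v∣ ⟩
    dot u u * dot v v               ≡⟨ dot*dot≡dot²+2det² u v ⟩
    dot u v * dot u v + + 2 * δ²    ≡⟨ cong (λ x → x * x + + 2 * δ²) u⊥v ⟩
    + 0 + + 2 * δ²                  ≡⟨ ℤ.+-identityˡ (+ 2 * δ²) ⟩
    + 2 * δ²                        ∎))
  where
  open ≡-Reasoning
  δ² : ℤ
  δ² = det u v * det u v

vec≡0⇒≡ : ∀ P Q → vec P Q ≡ (+ 0 , + 0) → P ≡ Q
vec≡0⇒≡ (x₁ , y₁) (x₂ , y₂) eq with ,-injective eq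
... | Δx≡0 , Δy≡0 = sym (cong₂ _,_ (ℤ.i-j≡0⇒i≡j x₂ x₁ Δx≡0) (ℤ.i-j≡0⇒i≡j y₂ y₁ Δy≡0))

lemma4p2 : (A B C D : LPoint) → ¬ IsSquare A B C D
lemma4p2 A B C D (_ , AB⊥AD , ∣AB∣≡∣AD∣ , A≢B) =
  A≢B (vec≡0⇒≡ A B (⊥-equal-length⇒≡0 (vec A B) (vec A D) AB⊥AD ∣AB∣≡∣AD∣))
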